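{- Over euclidean frames, both of the following are valid for propositional variables $r,q$: - $⌣r,\,⌣⌣r\models q$, i.e. explosion for $⌣$ with $p$ replaced by $⌣r$; - $q\models ⌢⌢r,\,⌢r$, i.e. implosion for $⌢$ with $p$ replaced by $⌢r$.
   Context: Kripke semantics with local truth-preserving entailment; a multiple conclusion holds if some conclusion is true. The unary negative modalities are: - $w\Vdash ⌣\varphi$ iff $\varphi$ is false at some $R$-successor of $w$. - $w\Vdash ⌢\varphi$ iff $\varphi$ is false at every $R$-successor of $w$. A frame is euclidean if $wRv$ and $wRu$ imply $vRu$. -}

module Defs where

open import Level using (0ℓ)
open import Data.Nat using (ℕ)
open import Data.Product using (Σ; _×_)
open import Data.Sum using (_⊎_)
open import Data.Empty using (⊥)
open import Data.List using (List)
open import Data.List.Relation.Unary.All using (All)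
open import Data.List.Relation.Unary.Any using (Any)
open import Relation.Nullary using (¬_)

data Form : Set where
  var  : ℕ → Form
  ~_   : Form → Form
  _∧_  : Form → Form → Form
  _∨_  : Form → Form → Form
  _⇒_  : Form → Form → Form
  ⌣_   : Form → Form
  ⌢_   : Form → Form

infixr 6 _∧_
infixr 5 _∨_
infixr 4 _⇒_
infix 8 ~_ ⌣_ ⌢_

record Frame : Set₁ where
  field
    W : Set
    R : W → W → Set

Euclidean : Frame → Set
Euclidean F = ∀ {w v u} → R w v → R w u → R v u
  where open Frame F

Valuation : Frame → Set₁
Valuation F = ℕ → Frame.W F → Set

⟦_,_⊩_⟧_ : (F : Frame) → Valuation F → Frame.W F → Form → Set
⟦_,_⊩_⟧_ F V w (var n) = V n w
⟦_,_⊩_⟧_ F V w (~ φ)   = ¬ (⟦_,_⊩_⟧_ F V w φ)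
⟦_,_⊩_⟧_ F V w (φ ∧ ψ) = ⟦_,_⊩_⟧_ F V w φ × ⟦_,_⊩_⟧_ F V w ψ
⟦_,_⊩_⟧_ F V w (φ ∨ ψ) = ⟦_,_⊩_⟧_ F V w φ ⊎ ⟦_,_⊩_⟧_ F V w ψ
⟦_,_⊩_⟧_ F V w (φ ⇒ ψ) = ⟦_,_⊩_⟧_ F V w φ → ⟦_,_⊩_⟧_ F V w ψ
⟦_,_⊩_⟧_ F V w (⌣ φ)   = Σ (Frame.W F) λ v → Frame.R F w v × ¬ (⟦_,_⊩_⟧_ F V v φ)
⟦_,_⊩_⟧_ F V w (⌢ φ)   = ∀ v → Frame.R F w v → ¬ (⟦_,_⊩_⟧_ F V v φ)

_⊨euc_ : List Form → List Form → Set₁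
Γ ⊨euc Δ = (F : Frame) → Euclidean F → (V : Valuation F) → (w : Frame.W F) →
           All (λ φ → ⟦ F , V ⊩ w ⟧ φ) Γ → Any (λ φ → ⟦ F , V ⊩ w ⟧ φ) Δ

-- On a euclidean frame any two successors of w see each other. Hence a
-- witness v for ⌣φ at w is also a witness for ⌣φ at every successor of w,
-- so ⌣⌣φ cannot hold alongside ⌣φ; dually, if ⌢φ fails at w because φ holds
-- at some successor u, then every successor of w sees u, so ⌢⌢φ holds.
module Submission where

open import Defs
open import Level using (0ℓ)
open import Data.Nat using (ℕ)
open import Data.Product using (_×_; _,_)
open import Data.Sum using (_⊎_; inj₁; inj₂)
open import Data.Empty using (⊥-elim)
open import Data.List using (_∷_; [])
open import Data.List.Relation.Unary.All using (_∷_; [])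
open import Data.List.Relation.Unary.Any using (here; there)
open import Axiom.ExcludedMiddle using (ExcludedMiddle)
open import Relation.Nullary using (¬_; yes; no)

module _ (F : Frame) (euc : Euclidean F) (V : Valuation F) where
  open Frame F

  ⌣-⌣⌣-inconsistent : ∀ {w} φ → ⟦ F , V ⊩ w ⟧ (⌣ φ) → ¬ ⟦ F , V ⊩ w ⟧ (⌣ ⌣ φ)
  ⌣-⌣⌣-inconsistent φ (v , wRv , ¬φv) (u , wRu , ¬⌣φu) = ¬⌣φu (v , euc wRu wRv , ¬φv)

  ¬⌢⇒⌢⌢ : ∀ {w} φ → ¬ ⟦ F , V ⊩ w ⟧ (⌢ φ) → ⟦ F , V ⊩ w ⟧ (⌢ ⌢ φ)
  ¬⌢⇒⌢⌢ φ ¬⌢φw v wRv ⌢φv = ¬⌢φw λ u wRu → ⌢φv u (euc wRv wRu)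

  ⌢⌢-or-⌢ : ExcludedMiddle 0ℓ → ∀ w φ → ⟦ F , V ⊩ w ⟧ (⌢ ⌢ φ) ⊎ ⟦ F , V ⊩ w ⟧ (⌢ φ)
  ⌢⌢-or-⌢ lem w φ with lem {⟦ F , V ⊩ w ⟧ (⌢ φ)}
  ... | yes ⌢φw = inj₂ ⌢φw
  ... | no ¬⌢φw = inj₁ (¬⌢⇒⌢⌢ φ ¬⌢φw)

mainTheorem9 : ExcludedMiddle 0ℓ → (r q : ℕ) →
    ((⌣ var r ∷ ⌣ ⌣ var r ∷ []) ⊨euc (var q ∷ []))
    × ((var q ∷ []) ⊨euc (⌢ ⌢ var r ∷ ⌢ var r ∷ []))
mainTheorem9 lem r q = explosion , implosion
  where
  explosion : (⌣ var r ∷ ⌣ ⌣ var r ∷ []) ⊨euc (var q ∷ [])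
  explosion F euc V w (⌣r ∷ ⌣⌣r ∷ []) =
    ⊥-elim (⌣-⌣⌣-inconsistent F euc V (var r) ⌣r ⌣⌣r)

  implosion : (var q ∷ []) ⊨euc (⌢ ⌢ var r ∷ ⌢ var r ∷ [])
  implosion F euc V w _ with ⌢⌢-or-⌢ F euc V lem w (var r)
  ... | inj₁ ⌢⌢r = here ⌢⌢r
  ... | inj₂ ⌢r  = there (here ⌢r)
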